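{- Let $G$ be the (undirected) threshold graph given by the sequence $(+^{p_l},0^{z_l},\dots,+^{p_1},0^{z_1},+^{p_0},\star)$, where $l\ge0$, $z_i\ge1$ and $p_i\ge 0$ are integers. Then the number of pairwise non-isomorphic transitive orientations of $G$ is $\prod_{i=1}^{l}(p_i+1)$.
   Context: A binary sequence over $\{+,0\}$ ending in $\star$ determines a threshold graph right to left: start with a single vertex (for $\star$); then, reading symbols from right to left, add for each $+$ a dominating vertex (adjacent to all existing vertices) and for each $0$ an isolated vertex. Here $+^{p}$ and $0^{z}$ denote $p$ copies of $+$ and $z$ copies of $0$. A transitive orientation of $G$ is an assignment of a direction to each edge such that $x\to y$ and $y\to z$ imply $x\to z$; two orientations are counted as the same if they are isomorphic as directed graphs. -}

module Defs where

open import Data.Nat using (ℕ; zero; suc; _<_; _≤_)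
open import Data.Fin using (Fin; toℕ) renaming (zero to fzero; suc to fsuc)
open import Data.Bool using (Bool; true; false)
open import Data.List using (List; []; _∷_; _++_; replicate; concatMap; length; lookup; map)
open import Data.List.Relation.Unary.All using (All)
open import Data.List.Relation.Unary.Any using (Any)
open import Data.List.Relation.Unary.AllPairs using (AllPairs)
open import Data.Maybe using (Maybe; just; nothing)
open import Data.Product using (Σ; _×_; _,_; proj₁; proj₂; ∃)
open import Data.Sum using (_⊎_)
open import Relation.Binary.PropositionalEquality using (_≡_)
open import Relation.Nullary using (¬_)
open import Function.Bundles using (_↔_; Inverse)

data Sym : Set where
  plus : Sym   -- "+" : dominating vertex
  zer  : Sym   -- "0" : isolated vertex

-- A sequence is stored in CONSTRUCTION order, i.e. the symbols of the
-- written sequence (…, ⋆) read from right to left, ⋆ omitted.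
-- Vertex fzero is the ⋆ vertex; vertex (fsuc k) is the k-th added vertex.
Vtx : List Sym → Set
Vtx s = Fin (suc (length s))

label : (s : List Sym) → Vtx s → Maybe Sym
label s fzero    = nothing
label s (fsuc k) = just (lookup s k)

Adj : (s : List Sym) → Vtx s → Vtx s → Set
Adj s i j = (toℕ i < toℕ j × label s j ≡ just plus)
          ⊎ (toℕ j < toℕ i × label s i ≡ just plus)

-- The sequence (+^{p_l},0^{z_l},…,+^{p_1},0^{z_1},+^{p_0},⋆) in construction
-- order, given p₀ and the list of blocks [(p₁,z₁), …, (p_l,z_l)].
thresholdSeq : ℕ → List (ℕ × ℕ) → List Sym
thresholdSeq p₀ bs =
  replicate p₀ plus ++ concatMap (λ b → replicate (proj₂ b) zer ++ replicate (proj₁ b) plus) bs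

-- Orientations on vertex set Fin n: O i j ≡ true means the arc i → j.
Orientation : ℕ → Set
Orientation n = Fin n → Fin n → Bool

record IsTransitiveOrientation {n : ℕ} (E : Fin n → Fin n → Set) (O : Orientation n) : Set where
  field
    arcs-are-edges : ∀ i j → O i j ≡ true → E i j
    edges-oriented : ∀ i j → E i j → O i j ≡ true ⊎ O j i ≡ true
    antisymmetric  : ∀ i j → O i j ≡ true → ¬ (O j i ≡ true)
    transitive     : ∀ i j k → O i j ≡ true → O j k ≡ true → O i k ≡ true

Isomorphic : {n : ℕ} → Orientation n → Orientation n → Set
Isomorphic {n} O O' = Σ (Fin n ↔ Fin n) λ σ →
  ∀ i j → O i j ≡ O' (Inverse.to σ i) (Inverse.to σ j)

NumTransOrientClasses : {n : ℕ} → (Fin n → Fin n → Set) → ℕ → Set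
NumTransOrientClasses {n} E k = Σ (List (Orientation n)) λ L →
  length L ≡ k
  × All (IsTransitiveOrientation E) L
  × AllPairs (λ O O' → ¬ Isomorphic O O') L
  × (∀ O → IsTransitiveOrientation E O → Any (Isomorphic O) L)

-- Let H = G ⊕ z be G with z ≥ 1 isolated vertices added (z₀ among them), and F = (H ∨ K_p) ⊕ m the
-- result of joining a clique K_p to H and then adding m further isolated vertices. A transitive
-- orientation of F restricts to one of H and to a linear order of K_p, and since z₀ has no neighbour in
-- H, transitivity forces every vertex of H to send arcs to the same up-set of that order. Hence the
-- orientation is determined up to isomorphism by its class on H and the size of the up-set, one of
-- p + 1 values. Conversely an isomorphism between two such orientations is a graph automorphism of F,
-- so it preserves K_p (for p ≥ 1 its vertices are the only ones adjacent to every other non-isolated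
-- vertex) and H; it therefore induces an isomorphism on H and an order automorphism of K_p, which is
-- the identity. Induction over the blocks of the sequence, starting from a clique, gives ∏ (p_i + 1).
module Submission where

open import Defs
open import Data.Bool using (Bool; true; false; not)
open import Data.Bool.Properties using (not-injective; ¬-not)
open import Data.Empty using (⊥; ⊥-elim)
open import Data.Fin using (Fin; toℕ; fromℕ<; punchOut; cast)
  renaming (zero to fzero; suc to fsuc; _<_ to _<ᶠ_)
open import Data.Fin.Properties
  using (toℕ-injective; toℕ-fromℕ<; toℕ<n; toℕ-cast; cast-involutive; toℕ-↑ˡ; toℕ-↑ʳ;
         suc-injective; any?; pigeonhole; punchOut-injective; +↔⊎; *↔×)
  renaming (_≟_ to _≟ᶠ_)
open import Data.Fin.Subset using (Subset; ∣_∣; _⊆_; _⊂_; _∈_)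
open import Data.Fin.Subset.Properties
  using (p⊆q⇒∣p∣≤∣q∣; p⊂q⇒∣p∣<∣q∣; ∣⊤∣≡n; ∣p∣≤n; ∈⊤)
open import Data.List using (List; []; _∷_; map; _++_; length; lookup; replicate; concatMap)
import Data.List as List
open import Data.List.Properties using (length-++; length-replicate; ++-assoc; ++-identityʳ; length-tabulate)
open import Data.List.Relation.Unary.All using (All; []; _∷_)
import Data.List.Relation.Unary.All.Properties as All
import Data.List.Relation.Unary.AllPairs.Properties as AllPairs
import Data.List.Relation.Unary.Any.Properties as Any
open import Data.Maybe using (Maybe; just; nothing)
open import Data.Nat using (ℕ; zero; suc; _+_; _*_; _≤_; _<_; _≤?_; _<?_; z≤n; s≤s; s≤s⁻¹)
open import Data.Nat.ListAction using (product)
open import Data.Nat.Properties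
  using (<-irrefl; <-asym; <-trans; <-cmp; <⇒≢; <⇒≤; <⇒≱; ≰⇒>; ≤-trans; ≤-reflexive;
         ≤-antisym; ≤-<-trans; <-≤-trans; n<1+n; m≤m+n; +-monoʳ-<; *-identityˡ; *-identityʳ; *-assoc)
open import Data.Product using (Σ; ∃; _×_; _,_; proj₁; proj₂)
open import Data.Sum using (_⊎_; inj₁; inj₂; swap)
open import Data.Sum.Algebra using (⊎-assoc)
open import Data.Sum.Function.Propositional using (_⊎-↔_)
open import Data.Unit using (⊤)
open import Data.Vec using (tabulate)
open import Data.Vec.Properties using (lookup∘tabulate; []=⇒lookup; lookup⇒[]=)
open import Function using (_∘_)
open import Function.Bundles using (_↔_; Inverse; mk↔ₛ′)
open import Function.Construct.Composition using (_↔-∘_)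
open import Function.Construct.Identity using (↔-id)
open import Function.Construct.Symmetry using (↔-sym)
open import Level using (0ℓ)
open import Relation.Binary using (tri<; tri≈; tri>)
open import Relation.Binary.PropositionalEquality
  using (_≡_; _≢_; refl; sym; trans; cong; cong₂; subst; subst₂; ≢-sym)
open import Relation.Nullary using (¬_; Dec; yes; no; does; contradiction)
open import Relation.Nullary.Decidable using (dec-true; dec-false)

open Inverse using (to; from; strictlyInverseˡ; strictlyInverseʳ)

does⇒ : {A : Set} (a? : Dec A) → does a? ≡ true → A
does⇒ (yes a) _ = a

true≢false : ∀ {b} → b ≡ true → b ≢ false
true≢false refl ()

-- Transitive orientations and their classification

Orient : Set → Set
Orient V = V → V → Bool

record IsTransOrient {V : Set} (E : V → V → Set) (O : Orient V) : Set where
  field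
    arcs-are-edges : ∀ i j → O i j ≡ true → E i j
    edges-oriented : ∀ i j → E i j → O i j ≡ true ⊎ O j i ≡ true
    antisymmetric  : ∀ i j → O i j ≡ true → ¬ (O j i ≡ true)
    transitive     : ∀ i j k → O i j ≡ true → O j k ≡ true → O i k ≡ true

  no-arc : ∀ i j → ¬ E i j → O i j ≡ false
  no-arc i j ¬e = ¬-not (¬e ∘ arcs-are-edges i j)

  irreflexive : ∀ i → O i i ≡ false
  irreflexive i = ¬-not λ e → antisymmetric i i e e

  reverse : ∀ i j → E i j → O j i ≡ not (O i j)
  reverse i j e with O i j in ij | O j i in ji
  ... | true  | true  = ⊥-elim (antisymmetric i j ij ji)
  ... | true  | false = refl
  ... | false | true  = refl
  ... | false | false with edges-oriented i j e
  ...   | inj₁ h = ⊥-elim (true≢false h ij)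
  ...   | inj₂ h = ⊥-elim (true≢false h ji)

comap : {A B : Set} → (A → B) → Orient B → Orient A
comap f O x y = O (f x) (f y)

restrict : {A V : Set} {E′ : A → A → Set} {E : V → V → Set} (f : A → V) →
  (∀ {x y} → E′ x y → E (f x) (f y)) → (∀ {x y} → E (f x) (f y) → E′ x y) →
  ∀ {O} → IsTransOrient E O → IsTransOrient E′ (comap f O)
restrict f preserves reflects t = record
  { arcs-are-edges = λ x y → reflects ∘ arcs-are-edges (f x) (f y)
  ; edges-oriented = λ x y → edges-oriented (f x) (f y) ∘ preserves
  ; antisymmetric  = λ x y → antisymmetric (f x) (f y)
  ; transitive     = λ x y z → transitive (f x) (f y) (f z) }
  where open IsTransOrient t

infix 4 _≅_

record _≅_ {A B : Set} (O : Orient A) (O′ : Orient B) : Set where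
  constructor mk≅
  field
    relabel : A ↔ B
    arcs    : ∀ i j → O i j ≡ O′ (to relabel i) (to relabel j)

open _≅_ using (relabel; arcs)

≅-sym : {A B : Set} {O : Orient A} {O′ : Orient B} → O ≅ O′ → O′ ≅ O
≅-sym {O = O} {O′} (mk≅ σ σ-arcs) = mk≅ (↔-sym σ) λ i j →
  sym (trans (σ-arcs (from σ i) (from σ j)) (cong₂ O′ (strictlyInverseˡ σ i) (strictlyInverseˡ σ j)))

≅-trans : {A B C : Set} {O : Orient A} {O′ : Orient B} {O″ : Orient C} →
  O ≅ O′ → O′ ≅ O″ → O ≅ O″
≅-trans (mk≅ σ σ-arcs) (mk≅ τ τ-arcs) =
  mk≅ (τ ↔-∘ σ) λ i j → trans (σ-arcs i j) (τ-arcs (to σ i) (to σ j))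

≅-comap : {A B : Set} (φ : A ↔ B) (O : Orient B) → comap (to φ) O ≅ O
≅-comap φ O = mk≅ φ λ _ _ → refl

restrict-↔ : {A X : Set} (ι : A → X) → (∀ {a b} → ι a ≡ ι b → a ≡ b) → (σ : X ↔ X) →
  (∀ a → ∃ λ b → ι b ≡ to σ (ι a)) → (∀ a → ∃ λ b → ι b ≡ from σ (ι a)) →
  Σ (A ↔ A) λ τ → ∀ a → ι (to τ a) ≡ to σ (ι a)
restrict-↔ {A} ι ι-injective σ forth back = mk↔ₛ′ f g f∘g g∘f , proj₂ ∘ forth
  where
  f g : A → A
  f = proj₁ ∘ forth
  g = proj₁ ∘ back
  f∘g : ∀ a → f (g a) ≡ a
  f∘g a = ι-injective
    (trans (proj₂ (forth (g a))) (trans (cong (to σ) (proj₂ (back a))) (strictlyInverseˡ σ (ι a))))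
  g∘f : ∀ a → g (f a) ≡ a
  g∘f a = ι-injective
    (trans (proj₂ (back (f a))) (trans (cong (from σ) (proj₂ (forth a))) (strictlyInverseʳ σ (ι a))))

-- NumTransOrientClasses of Defs, with the representatives indexed by I.
record Classification {V : Set} (E : V → V → Set) (I : Set) : Set where
  field
    rep            : I → Orient V
    rep-transitive : ∀ i → IsTransOrient E (rep i)
    rep-distinct   : ∀ i j → rep i ≅ rep j → i ≡ j
    classify       : ∀ O → IsTransOrient E O → ∃ λ i → O ≅ rep i

reindex : {V : Set} {E : V → V → Set} {I J : Set} → I ↔ J → Classification E I → Classification E J
reindex {E = E} σ c = record
  { rep            = rep ∘ from σ
  ; rep-transitive = rep-transitive ∘ from σ
  ; rep-distinct   = λ i j r → trans (sym (strictlyInverseˡ σ i))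
                       (trans (cong (to σ) (rep-distinct _ _ r)) (strictlyInverseˡ σ j))
  ; classify       = classify′ }
  where
  open Classification c
  classify′ : ∀ O → IsTransOrient E O → ∃ λ j → O ≅ rep (from σ j)
  classify′ O t with classify O t
  ... | i , O≅ = to σ i , subst (λ k → O ≅ rep k) (sym (strictlyInverseʳ σ i)) O≅

-- Linear orders on Fin p

injective⇒surjective : ∀ {p} (f : Fin p → Fin p) → (∀ {u v} → f u ≡ f v → u ≡ v) →
  ∀ y → ∃ λ u → f u ≡ y
injective⇒surjective {suc p} f f-inj y with any? (λ u → f u ≟ᶠ y)
... | yes found = found
... | no ¬found = contradiction (pigeonhole (n<1+n p) squeeze) collision-free
  where
  miss : ∀ u → y ≢ f u
  miss u e = ¬found (u , sym e)
  squeeze : Fin (suc p) → Fin p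
  squeeze u = punchOut (miss u)
  collision-free : ¬ ∃ λ i → ∃ λ j → i <ᶠ j × squeeze i ≡ squeeze j
  collision-free (i , j , i<j , eq) =
    <-irrefl (cong toℕ (f-inj (punchOut-injective (miss i) (miss j) eq))) i<j

injective⇒↔ : ∀ {p} (f : Fin p → Fin p) → (∀ {u v} → f u ≡ f v → u ≡ v) → Fin p ↔ Fin p
injective⇒↔ f f-inj =
  mk↔ₛ′ f (proj₁ ∘ preimage) (proj₂ ∘ preimage) (λ x → f-inj (proj₂ (preimage (f x))))
  where
  preimage : ∀ y → ∃ λ u → f u ≡ y
  preimage = injective⇒surjective f f-inj

∈-tabulate⁺ : ∀ {p} {f : Fin p → Bool} {v} → f v ≡ true → v ∈ tabulate f
∈-tabulate⁺ {f = f} {v} e = lookup⇒[]= v (tabulate f) (trans (lookup∘tabulate f v) e)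

∈-tabulate⁻ : ∀ {p} {f : Fin p → Bool} {v} → v ∈ tabulate f → f v ≡ true
∈-tabulate⁻ {f = f} {v} v∈ = trans (sym (lookup∘tabulate f v)) ([]=⇒lookup v∈)

-- Opaque, so that unification does not unfold it into _<ᵇ_ and lose track of u and v.
opaque
  ascending : ∀ {p} → Orient (Fin p)
  ascending u v = does (toℕ u <? toℕ v)

  ascending⇒< : ∀ {p} {u v : Fin p} → ascending u v ≡ true → toℕ u < toℕ v
  ascending⇒< {u = u} {v} = does⇒ (toℕ u <? toℕ v)

  <⇒ascending : ∀ {p} {u v : Fin p} → toℕ u < toℕ v → ascending u v ≡ true
  <⇒ascending {u = u} {v} = dec-true (toℕ u <? toℕ v)

  ≮⇒ascending : ∀ {p} {u v : Fin p} → ¬ (toℕ u < toℕ v) → ascending u v ≡ false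
  ≮⇒ascending {u = u} {v} = dec-false (toℕ u <? toℕ v)

ascending-transitive : ∀ {p} → IsTransOrient {Fin p} _≢_ ascending
ascending-transitive = record
  { arcs-are-edges = λ u v e u≡v → <-irrefl (cong toℕ u≡v) (ascending⇒< e)
  ; edges-oriented = oriented
  ; antisymmetric  = λ u v e e′ → <-asym (ascending⇒< e) (ascending⇒< e′)
  ; transitive     = λ u v w e e′ → <⇒ascending (<-trans (ascending⇒< e) (ascending⇒< e′)) }
  where
  oriented : ∀ {p} (u v : Fin p) → u ≢ v → ascending u v ≡ true ⊎ ascending v u ≡ true
  oriented u v u≢v with <-cmp (toℕ u) (toℕ v)
  ... | tri< u<v _ _ = inj₁ (<⇒ascending u<v)
  ... | tri≈ _ u≡v _ = contradiction (toℕ-injective u≡v) u≢v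
  ... | tri> _ _ v<u = inj₂ (<⇒ascending v<u)

opaque
  above : ∀ {p} → Fin (suc p) → Fin p → Bool
  above a u = does (toℕ a ≤? toℕ u)

  above⇒≤ : ∀ {p} {a : Fin (suc p)} {u : Fin p} → above a u ≡ true → toℕ a ≤ toℕ u
  above⇒≤ {a = a} {u} = does⇒ (toℕ a ≤? toℕ u)

  ≤⇒above : ∀ {p} {a : Fin (suc p)} {u : Fin p} → toℕ a ≤ toℕ u → above a u ≡ true
  ≤⇒above {a = a} {u} = dec-true (toℕ a ≤? toℕ u)

  ≰⇒above : ∀ {p} {a : Fin (suc p)} {u : Fin p} → ¬ (toℕ a ≤ toℕ u) → above a u ≡ false
  ≰⇒above {a = a} {u} = dec-false (toℕ a ≤? toℕ u)

above-separates : ∀ {p} {a b : Fin (suc p)} → toℕ a < toℕ b → ¬ (∀ u → above a u ≡ above b u)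
above-separates {p} {a} {b} a<b h = true≢false (trans (sym (h u)) a-above) b-not-above
  where
  a<p : toℕ a < p
  a<p = <-≤-trans a<b (s≤s⁻¹ (toℕ<n b))
  u : Fin p
  u = fromℕ< a<p
  a-above : above a u ≡ true
  a-above = ≤⇒above (≤-reflexive (sym (toℕ-fromℕ< a<p)))
  b-not-above : above b u ≡ false
  b-not-above = ≰⇒above (<⇒≱ (subst (_< toℕ b) (sym (toℕ-fromℕ< a<p)) a<b))

above-injective : ∀ {p} {a b : Fin (suc p)} → (∀ u → above a u ≡ above b u) → a ≡ b
above-injective {a = a} {b} h with <-cmp (toℕ a) (toℕ b)
... | tri< a<b _ _ = contradiction h (above-separates a<b)
... | tri≈ _ a≡b _ = toℕ-injective a≡b
... | tri> _ _ b<a = contradiction (sym ∘ h) (above-separates b<a)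

increasing⇒inflationary : ∀ {p} (f : Fin p → Fin p) →
  (∀ {u v} → toℕ u < toℕ v → toℕ (f u) < toℕ (f v)) → ∀ u → toℕ u ≤ toℕ (f u)
increasing⇒inflationary {p} f increasing u = go (toℕ u) u refl
  where
  go : ∀ n u → toℕ u ≡ n → n ≤ toℕ (f u)
  go zero    u _  = z≤n
  go (suc n) u eq = ≤-<-trans (go n v (toℕ-fromℕ< n<p)) (increasing v<u)
    where
    n<p : n < p
    n<p = <⇒≤ (subst (_< p) eq (toℕ<n u))
    v : Fin p
    v = fromℕ< n<p
    v<u : toℕ v < toℕ u
    v<u = subst₂ _<_ (sym (toℕ-fromℕ< n<p)) (sym eq) (n<1+n n)

ascending-automorphism-is-id : ∀ {p} (τ : Fin p ↔ Fin p) →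
  (∀ u v → ascending u v ≡ ascending (to τ u) (to τ v)) → ∀ u → to τ u ≡ u
ascending-automorphism-is-id τ τ-ascending u = toℕ-injective (≤-antisym
  (subst (λ x → toℕ (to τ u) ≤ toℕ x) (strictlyInverseʳ τ u)
    (increasing⇒inflationary (from τ) (increasing (from τ) from-ascending) (to τ u)))
  (increasing⇒inflationary (to τ) (increasing (to τ) τ-ascending) u))
  where
  increasing : ∀ f → (∀ u v → ascending u v ≡ ascending (f u) (f v)) →
    ∀ {u v} → toℕ u < toℕ v → toℕ (f u) < toℕ (f v)
  increasing f f-ascending {u} {v} u<v = ascending⇒< (trans (sym (f-ascending u v)) (<⇒ascending u<v))
  from-ascending : ∀ u v → ascending u v ≡ ascending (from τ u) (from τ v)
  from-ascending u v = sym (trans (τ-ascending (from τ u) (from τ v))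
    (cong₂ ascending (strictlyInverseˡ τ u) (strictlyInverseˡ τ v)))

module Ranking {p : ℕ} {R : Orient (Fin p)} (R-transitive : IsTransOrient _≢_ R) where
  open IsTransOrient R-transitive

  below : Fin p → Subset p
  below u = tabulate (λ v → R v u)

  ∉-below-self : ∀ u → ¬ (u ∈ below u)
  ∉-below-self u u∈ = true≢false (∈-tabulate⁻ u∈) (irreflexive u)

  below-⊂ : ∀ {u v} → R u v ≡ true → below u ⊂ below v
  below-⊂ {u} {v} uv = (λ w∈ → ∈-tabulate⁺ (transitive _ u v (∈-tabulate⁻ w∈) uv))
                     , u , ∈-tabulate⁺ uv , ∉-below-self u

  rank< : ∀ u → ∣ below u ∣ < p
  rank< u = subst (∣ below u ∣ <_) (∣⊤∣≡n p)
    (p⊂q⇒∣p∣<∣q∣ ((λ _ → ∈⊤) , u , ∈⊤ , ∉-below-self u))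

  rank : Fin p → Fin p
  rank u = fromℕ< (rank< u)

  rank-increasing : ∀ {u v} → R u v ≡ true → toℕ (rank u) < toℕ (rank v)
  rank-increasing {u} {v} uv =
    subst₂ _<_ (sym (toℕ-fromℕ< (rank< u))) (sym (toℕ-fromℕ< (rank< v)))
      (p⊂q⇒∣p∣<∣q∣ (below-⊂ uv))

  rank-injective : ∀ {u v} → rank u ≡ rank v → u ≡ v
  rank-injective {u} {v} eq with u ≟ᶠ v
  ... | yes u≡v = u≡v
  ... | no u≢v with edges-oriented u v u≢v
  ...   | inj₁ uv = contradiction (cong toℕ eq) (<⇒≢ (rank-increasing uv))
  ...   | inj₂ vu = contradiction (cong toℕ eq) (≢-sym (<⇒≢ (rank-increasing vu)))

  ranking : Fin p ↔ Fin p
  ranking = injective⇒↔ rank rank-injective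

  ranked : R ≅ ascending {p}
  ranked = mk≅ ranking order
    where
    order : ∀ u v → R u v ≡ ascending (rank u) (rank v)
    order u v with R u v in uv
    ... | true  = sym (<⇒ascending (rank-increasing uv))
    ... | false = sym (≮⇒ascending not-below)
      where
      not-below : ¬ (toℕ (rank u) < toℕ (rank v))
      not-below lt with u ≟ᶠ v
      ... | yes refl = <-irrefl refl lt
      ... | no u≢v with edges-oriented u v u≢v
      ...   | inj₁ uv′ = true≢false uv′ uv
      ...   | inj₂ vu  = <-asym lt (rank-increasing vu)

  module _ (T : Fin p → Bool) (T-upward : ∀ u v → T u ≡ true → R u v ≡ true → T v ≡ true) where

    lower : Subset p
    lower = tabulate (not ∘ T)

    threshold : Fin (suc p)
    threshold = fromℕ< (s≤s (∣p∣≤n lower))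

    ∈-lower⁺ : ∀ {w} → T w ≡ false → w ∈ lower
    ∈-lower⁺ Tw = ∈-tabulate⁺ (cong not Tw)

    ∈-lower⁻ : ∀ {w} → w ∈ lower → T w ≡ false
    ∈-lower⁻ w∈ = not-injective (∈-tabulate⁻ w∈)

    lower-downward : ∀ {w v} → T v ≡ false → R w v ≡ true → T w ≡ false
    lower-downward Tv wv = ¬-not λ Tw → true≢false (T-upward _ _ Tw wv) Tv

    ranked-above : ∀ u → T u ≡ above threshold (rank u)
    ranked-above u with T u in Tu
    ... | true  = sym (≤⇒above (subst₂ _≤_ (sym (toℕ-fromℕ< _)) (sym (toℕ-fromℕ< _))
                    (p⊆q⇒∣p∣≤∣q∣ lower⊆below)))
      where
      lower⊆below : lower ⊆ below u
      lower⊆below {w} w∈ with w ≟ᶠ u | ∈-lower⁻ w∈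
      ... | yes refl | Tw = contradiction Tw (true≢false Tu)
      ... | no w≢u   | Tw with edges-oriented w u w≢u
      ...   | inj₁ wu = ∈-tabulate⁺ wu
      ...   | inj₂ uw = contradiction Tw (true≢false (T-upward u w Tu uw))
    ... | false = sym (≰⇒above (<⇒≱ (subst₂ _<_ (sym (toℕ-fromℕ< _)) (sym (toℕ-fromℕ< _))
                    (p⊂q⇒∣p∣<∣q∣ below⊂lower))))
      where
      below⊂lower : below u ⊂ lower
      below⊂lower = (λ w∈ → ∈-lower⁺ (lower-downward Tu (∈-tabulate⁻ w∈)))
                  , u , ∈-lower⁺ Tu , ∉-below-self u

-- Graphs with added isolated vertices and joined cliques

record Graph : Set₁ where
  field
    V     : Set
    E     : V → V → Set
    E-sym : ∀ {x y} → E x y → E y x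

open Graph

E⊕ : (G : Graph) (m : ℕ) → V G ⊎ Fin m → V G ⊎ Fin m → Set
E⊕ G m (inj₁ a) (inj₁ b) = E G a b
E⊕ G m _        _        = ⊥

E⊕-sym : ∀ G m x y → E⊕ G m x y → E⊕ G m y x
E⊕-sym G m (inj₁ a) (inj₁ b) e = E-sym G e

infixl 6 _⊕_ _∨_
infix 4 _≃_

_⊕_ : Graph → ℕ → Graph
G ⊕ m = record { V = V G ⊎ Fin m ; E = E⊕ G m ; E-sym = λ {x} {y} → E⊕-sym G m x y }

E∨ : (G : Graph) (p : ℕ) → V G ⊎ Fin p → V G ⊎ Fin p → Set
E∨ G p (inj₁ a) (inj₁ b) = E G a b
E∨ G p (inj₂ u) (inj₂ v) = u ≢ v
E∨ G p _        _        = ⊤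

E∨-sym : ∀ G p x y → E∨ G p x y → E∨ G p y x
E∨-sym G p (inj₁ a) (inj₁ b) e = E-sym G e
E∨-sym G p (inj₁ a) (inj₂ v) e = _
E∨-sym G p (inj₂ u) (inj₁ b) e = _
E∨-sym G p (inj₂ u) (inj₂ v) e = e ∘ sym

_∨_ : Graph → ℕ → Graph
G ∨ p = record { V = V G ⊎ Fin p ; E = E∨ G p ; E-sym = λ {x} {y} → E∨-sym G p x y }

complete : ℕ → Graph
complete p = record { V = Fin p ; E = _≢_ ; E-sym = _∘ sym }

record _≃_ (G H : Graph) : Set where
  field
    bij       : V G ↔ V H
    preserves : ∀ {x y} → E G x y → E H (to bij x) (to bij y)
    reflects  : ∀ {x y} → E H (to bij x) (to bij y) → E G x y

open _≃_

mk≃ : ∀ {G H} (σ : V G ↔ V H) → (∀ x y → E G x y → E H (to σ x) (to σ y)) →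
  (∀ x y → E H (to σ x) (to σ y) → E G x y) → G ≃ H
mk≃ σ forth back =
  record { bij = σ ; preserves = λ {x} {y} → forth x y ; reflects = λ {x} {y} → back x y }

≃-sym : ∀ {G H} → G ≃ H → H ≃ G
≃-sym {G} {H} φ = record
  { bij       = ↔-sym (bij φ)
  ; preserves = λ e → reflects φ (subst₂ (E H) (sym (to∘from _)) (sym (to∘from _)) e)
  ; reflects  = λ e → subst₂ (E H) (to∘from _) (to∘from _) (preserves φ e) }
  where
  to∘from : ∀ y → to (bij φ) (from (bij φ) y) ≡ y
  to∘from = strictlyInverseˡ (bij φ)

≃-trans : ∀ {G H K} → G ≃ H → H ≃ K → G ≃ K
≃-trans φ ψ = record
  { bij       = bij ψ ↔-∘ bij φ
  ; preserves = preserves ψ ∘ preserves φ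
  ; reflects  = reflects φ ∘ reflects ψ }

⊕-cong : ∀ {G H} → G ≃ H → ∀ m → G ⊕ m ≃ H ⊕ m
⊕-cong {G} {H} φ m = mk≃ σ forth back
  where
  σ : (V G ⊎ Fin m) ↔ (V H ⊎ Fin m)
  σ = bij φ ⊎-↔ ↔-id (Fin m)
  forth : ∀ x y → E (G ⊕ m) x y → E (H ⊕ m) (to σ x) (to σ y)
  forth (inj₁ a) (inj₁ b) e = preserves φ e
  back : ∀ x y → E (H ⊕ m) (to σ x) (to σ y) → E (G ⊕ m) x y
  back (inj₁ a) (inj₁ b) e = reflects φ e

∨-cong : ∀ {G H} → G ≃ H → ∀ p → G ∨ p ≃ H ∨ p
∨-cong {G} {H} φ p = mk≃ σ forth back
  where
  σ : (V G ⊎ Fin p) ↔ (V H ⊎ Fin p)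
  σ = bij φ ⊎-↔ ↔-id (Fin p)
  forth : ∀ x y → E (G ∨ p) x y → E (H ∨ p) (to σ x) (to σ y)
  forth (inj₁ a) (inj₁ b) e = preserves φ e
  forth (inj₁ a) (inj₂ v) e = e
  forth (inj₂ u) (inj₁ b) e = e
  forth (inj₂ u) (inj₂ v) e = e
  back : ∀ x y → E (H ∨ p) (to σ x) (to σ y) → E (G ∨ p) x y
  back (inj₁ a) (inj₁ b) e = reflects φ e
  back (inj₁ a) (inj₂ v) e = e
  back (inj₂ u) (inj₁ b) e = e
  back (inj₂ u) (inj₂ v) e = e

⊎-Fin0 : (A : Set) → (A ⊎ Fin 0) ↔ A
⊎-Fin0 A = mk↔ₛ′ drop inj₁ (λ _ → refl) (λ { (inj₁ _) → refl })
  where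
  drop : A ⊎ Fin 0 → A
  drop (inj₁ a) = a

⊕-zero : ∀ G → G ⊕ 0 ≃ G
⊕-zero G = mk≃ σ forth back
  where
  σ : (V G ⊎ Fin 0) ↔ V G
  σ = ⊎-Fin0 (V G)
  forth : ∀ x y → E (G ⊕ 0) x y → E G (to σ x) (to σ y)
  forth (inj₁ a) (inj₁ b) e = e
  back : ∀ x y → E G (to σ x) (to σ y) → E (G ⊕ 0) x y
  back (inj₁ a) (inj₁ b) e = e

∨-zero : ∀ G → G ∨ 0 ≃ G
∨-zero G = mk≃ σ forth back
  where
  σ : (V G ⊎ Fin 0) ↔ V G
  σ = ⊎-Fin0 (V G)
  forth : ∀ x y → E (G ∨ 0) x y → E G (to σ x) (to σ y)
  forth (inj₁ a) (inj₁ b) e = e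
  back : ∀ x y → E G (to σ x) (to σ y) → E (G ∨ 0) x y
  back (inj₁ a) (inj₁ b) e = e

⊕-⊕ : ∀ G z m → (G ⊕ z) ⊕ m ≃ G ⊕ (z + m)
⊕-⊕ G z m = mk≃ σ forth back
  where
  σ : ((V G ⊎ Fin z) ⊎ Fin m) ↔ (V G ⊎ Fin (z + m))
  σ = (↔-id (V G) ⊎-↔ ↔-sym +↔⊎) ↔-∘ ⊎-assoc 0ℓ (V G) (Fin z) (Fin m)
  forth : ∀ x y → E ((G ⊕ z) ⊕ m) x y → E (G ⊕ (z + m)) (to σ x) (to σ y)
  forth (inj₁ (inj₁ a)) (inj₁ (inj₁ b)) e = e
  back : ∀ x y → E (G ⊕ (z + m)) (to σ x) (to σ y) → E ((G ⊕ z) ⊕ m) x y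
  back (inj₁ (inj₁ a)) (inj₁ (inj₁ b)) e = e

transport : ∀ {G H I} → G ≃ H → Classification (E G) I → Classification (E H) I
transport {G} {H} φ c = record
  { rep            = λ i → comap (from (bij φ)) (rep i)
  ; rep-transitive = λ i →
      restrict (from (bij φ)) (preserves (≃-sym φ)) (reflects (≃-sym φ)) (rep-transitive i)
  ; rep-distinct   = λ i j r → rep-distinct i j (≅-trans (≅-sym (pulled i)) (≅-trans r (pulled j)))
  ; classify       = classify′ }
  where
  open Classification c
  pulled : ∀ i → comap (from (bij φ)) (rep i) ≅ rep i
  pulled i = ≅-comap (↔-sym (bij φ)) (rep i)
  classify′ : ∀ O → IsTransOrient (E H) O → ∃ λ i → O ≅ comap (from (bij φ)) (rep i)
  classify′ O t with classify (comap (to (bij φ)) O) (restrict (to (bij φ)) (preserves φ) (reflects φ) t)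
  ... | i , O≅ = i , ≅-trans (≅-sym (≅-comap (bij φ) O)) (≅-trans O≅ (≅-sym (pulled i)))

≅⇒automorphism : ∀ {G} {O O′ : Orient (V G)} → IsTransOrient (E G) O → IsTransOrient (E G) O′ →
  O ≅ O′ → G ≃ G
≅⇒automorphism {G} t t′ (mk≅ σ σ-arcs) = mk≃ σ forth back
  where
  forth : ∀ x y → E G x y → E G (to σ x) (to σ y)
  forth x y e with IsTransOrient.edges-oriented t x y e
  ... | inj₁ xy = IsTransOrient.arcs-are-edges t′ _ _ (trans (sym (σ-arcs x y)) xy)
  ... | inj₂ yx = E-sym G (IsTransOrient.arcs-are-edges t′ _ _ (trans (sym (σ-arcs y x)) yx))
  back : ∀ x y → E G (to σ x) (to σ y) → E G x y
  back x y e with IsTransOrient.edges-oriented t′ _ _ e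
  ... | inj₁ xy = IsTransOrient.arcs-are-edges t x y (trans (σ-arcs x y) xy)
  ... | inj₂ yx = E-sym G (IsTransOrient.arcs-are-edges t y x (trans (σ-arcs y x) yx))

-- Orientations of a join

extend : ∀ {A : Set} {m} → Orient A → Orient (A ⊎ Fin m)
extend O (inj₁ x) (inj₁ y) = O x y
extend O _        _        = false

extend-transitive : ∀ {G m O} → IsTransOrient (E G) O → IsTransOrient (E (G ⊕ m)) (extend O)
extend-transitive {G} {m} {O} t = record
  { arcs-are-edges = λ { (inj₁ x) (inj₁ y) → arcs-are-edges x y }
  ; edges-oriented = λ { (inj₁ x) (inj₁ y) → edges-oriented x y }
  ; antisymmetric  = λ { (inj₁ x) (inj₁ y) → antisymmetric x y }
  ; transitive     = λ { (inj₁ x) (inj₁ y) (inj₁ z) → transitive x y z } }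
  where open IsTransOrient t

above-false⇒< : ∀ {p} {a : Fin (suc p)} {u} → above a u ≡ false → toℕ u < toℕ a
above-false⇒< e = ≰⇒> λ le → true≢false (≤⇒above le) e

module _ {p : ℕ} {a : Fin (suc p)} {u v : Fin p} where

  above-upward : above a u ≡ true → ascending u v ≡ true → above a v ≡ true
  above-upward au uv = ≤⇒above (≤-trans (above⇒≤ au) (<⇒≤ (ascending⇒< uv)))

  below-downward : ascending u v ≡ true → above a v ≡ false → above a u ≡ false
  below-downward uv av = ¬-not λ au → true≢false (above-upward au uv) av

  below<above : above a u ≡ false → above a v ≡ true → ascending u v ≡ true
  below<above au av = <⇒ascending (<-≤-trans (above-false⇒< au) (above⇒≤ av))

-- G is inserted into the ascending order of the clique just below position a.
between : ∀ {A : Set} {p} → Orient A → Fin (suc p) → Orient (A ⊎ Fin p)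
between C a (inj₁ x) (inj₁ y) = C x y
between C a (inj₁ x) (inj₂ v) = above a v
between C a (inj₂ u) (inj₁ y) = not (above a u)
between C a (inj₂ u) (inj₂ v) = ascending u v

between-transitive : ∀ {G p C} {a : Fin (suc p)} →
  IsTransOrient (E G) C → IsTransOrient (E (G ∨ p)) (between C a)
between-transitive {G} {p} {C} {a} t = record
  { arcs-are-edges = edges ; edges-oriented = oriented ; antisymmetric = antisym ; transitive = trans′ }
  where
  open IsTransOrient t
  module K = IsTransOrient (ascending-transitive {p})
  B : Orient (V G ⊎ Fin p)
  B = between C a
  edges : ∀ x y → B x y ≡ true → E (G ∨ p) x y
  edges (inj₁ x) (inj₁ y) = arcs-are-edges x y
  edges (inj₁ x) (inj₂ v) _ = _
  edges (inj₂ u) (inj₁ y) _ = _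
  edges (inj₂ u) (inj₂ v) = K.arcs-are-edges u v
  oriented : ∀ x y → E (G ∨ p) x y → B x y ≡ true ⊎ B y x ≡ true
  oriented (inj₁ x) (inj₁ y) = edges-oriented x y
  oriented (inj₁ x) (inj₂ v) _ with above a v
  ... | true  = inj₁ refl
  ... | false = inj₂ refl
  oriented (inj₂ u) (inj₁ y) _ with above a u
  ... | true  = inj₂ refl
  ... | false = inj₁ refl
  oriented (inj₂ u) (inj₂ v) = K.edges-oriented u v
  antisym : ∀ x y → B x y ≡ true → ¬ (B y x ≡ true)
  antisym (inj₁ x) (inj₁ y) = antisymmetric x y
  antisym (inj₁ x) (inj₂ v) xv vx = true≢false xv (not-injective vx)
  antisym (inj₂ u) (inj₁ y) uy yu = true≢false yu (not-injective uy)
  antisym (inj₂ u) (inj₂ v) = K.antisymmetric u v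
  trans′ : ∀ x y z → B x y ≡ true → B y z ≡ true → B x z ≡ true
  trans′ (inj₁ x) (inj₁ y) (inj₁ z) xy yz = transitive x y z xy yz
  trans′ (inj₁ x) (inj₁ y) (inj₂ w) xy yw = yw
  trans′ (inj₁ x) (inj₂ v) (inj₁ z) xv vz = ⊥-elim (true≢false xv (not-injective vz))
  trans′ (inj₁ x) (inj₂ v) (inj₂ w) xv vw = above-upward xv vw
  trans′ (inj₂ u) (inj₁ y) (inj₁ z) uy yz = uy
  trans′ (inj₂ u) (inj₁ y) (inj₂ w) uy yw = below<above (not-injective uy) yw
  trans′ (inj₂ u) (inj₂ v) (inj₁ z) uv vz = cong not (below-downward uv (not-injective vz))
  trans′ (inj₂ u) (inj₂ v) (inj₂ w) = K.transitive u v w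

-- Counting orientations block by block

complete⊕-classification : ∀ c m → Classification (E (complete c ⊕ m)) (Fin 1)
complete⊕-classification c m = record
  { rep            = λ _ → extend ascending
  ; rep-transitive = λ _ → extend-transitive ascending-transitive
  ; rep-distinct   = λ { fzero fzero _ → refl }
  ; classify       = λ O t → fzero , sorted O t }
  where
  sorted : ∀ O → IsTransOrient (E (complete c ⊕ m)) O → O ≅ extend ascending
  sorted O t = mk≅ σ arcs′
    where
    open IsTransOrient t
    open Ranking (restrict inj₁ (λ e → e) (λ e → e) t)
    σ : (Fin c ⊎ Fin m) ↔ (Fin c ⊎ Fin m)
    σ = ranking ⊎-↔ ↔-id (Fin m)
    arcs′ : ∀ x y → O x y ≡ extend ascending (to σ x) (to σ y)
    arcs′ (inj₁ u) (inj₁ v) = arcs ranked u v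
    arcs′ (inj₁ u) (inj₂ w) = no-arc _ _ λ ()
    arcs′ (inj₂ w) y        = no-arc _ _ λ ()

-- Classifying G ⊕ m for every m, rather than G alone, lets the induction absorb the isolated vertices
-- of the next block; a vertex of G is needed to tell the next clique apart from G (see stranger).
record Classified (G : Graph) (k : ℕ) : Set where
  field
    vertex         : V G
    classification : ∀ m → Classification (E (G ⊕ m)) (Fin k)

module Step {G : Graph} {k : ℕ} (cG : Classified G k) (z′ q m : ℕ) where
  module CG = Classified cG

  H F : Graph
  H = G ⊕ suc z′
  F = H ∨ suc q ⊕ m

  module CH = Classification (CG.classification (suc z′))

  ιH : V H → V F
  ιH h = inj₁ (inj₁ h)

  ιP : Fin (suc q) → V F
  ιP u = inj₁ (inj₂ u)

  ιH-injective : ∀ {h h′} → ιH h ≡ ιH h′ → h ≡ h′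
  ιH-injective refl = refl

  ιP-injective : ∀ {u u′} → ιP u ≡ ιP u′ → u ≡ u′
  ιP-injective refl = refl

  z₀ : V H
  z₀ = inj₂ fzero

  z₀-isolated : ∀ h → ¬ E H h z₀
  z₀-isolated h = E-sym H {h} {z₀}

  rep : Fin k × Fin (suc (suc q)) → Orient (V F)
  rep (i , a) = extend (between (CH.rep i) a)

  rep-transitive : ∀ j → IsTransOrient (E F) (rep j)
  rep-transitive (i , a) = extend-transitive (between-transitive (CH.rep-transitive i))

  -- This is where G being nonempty and z ≥ 1 are used.
  stranger : V H → V H
  stranger (inj₁ _) = z₀
  stranger (inj₂ _) = inj₁ CG.vertex

  stranger-≢ : ∀ h → stranger h ≢ h
  stranger-≢ (inj₁ _) ()
  stranger-≢ (inj₂ _) ()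

  stranger-¬E : ∀ h → ¬ E H (stranger h) h
  stranger-¬E (inj₁ _) ()
  stranger-¬E (inj₂ _) ()

  Dominating : V F → Set
  Dominating x = ∀ y → y ≢ x → (∃ λ w → E F y w) → E F x y

  ιP-dominating : ∀ u → Dominating (ιP u)
  ιP-dominating u (inj₁ (inj₁ h)) _   _       = _
  ιP-dominating u (inj₁ (inj₂ v)) v≢u _       = v≢u ∘ cong ιP ∘ sym
  ιP-dominating u (inj₂ w)        _   (_ , ())

  dominating⇒ιP : ∀ x → Dominating x → ∃ λ u → ιP u ≡ x
  dominating⇒ιP (inj₁ (inj₂ u)) _ = u , refl
  dominating⇒ιP (inj₁ (inj₁ h)) d = ⊥-elim (stranger-¬E h (E-sym H {h}
    (d (ιH (stranger h)) (stranger-≢ h ∘ ιH-injective) (ιP fzero , _))))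
  dominating⇒ιP (inj₂ w)        d = ⊥-elim (d (ιP fzero) (λ ()) (ιH z₀ , _))

  automorphism-dominating : (α : F ≃ F) → ∀ {x} → Dominating x → Dominating (to (bij α) x)
  automorphism-dominating α {x} d y y≢ (w , yw) =
    subst (E F (to σ x)) (strictlyInverseˡ σ y)
      (preserves α (d (from σ y) (λ eq → y≢ (trans (sym (strictlyInverseˡ σ y)) (cong (to σ) eq)))
                      (from σ w , preserves (≃-sym α) yw)))
    where
    σ : V F ↔ V F
    σ = bij α

  automorphism-keeps-ιP : (α : F ≃ F) → ∀ u → ∃ λ u′ → ιP u′ ≡ to (bij α) (ιP u)
  automorphism-keeps-ιP α u = dominating⇒ιP _ (automorphism-dominating α (ιP-dominating u))

  automorphism-keeps-ιH : (α : F ≃ F) → ∀ h → ∃ λ h′ → ιH h′ ≡ to (bij α) (ιH h)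
  automorphism-keeps-ιH α h with to (bij α) (ιH h) in αh
  ... | inj₁ (inj₁ h′) = h′ , refl
  ... | inj₁ (inj₂ u′) =
    contradiction (trans (proj₂ (automorphism-keeps-ιP (≃-sym α) u′)) α⁻¹ιPu′) λ ()
    where
    α⁻¹ιPu′ : from (bij α) (ιP u′) ≡ ιH h
    α⁻¹ιPu′ = trans (cong (from (bij α)) (sym αh)) (strictlyInverseʳ (bij α) (ιH h))
  ... | inj₂ w =
    ⊥-elim (subst (λ x → E F x (to (bij α) (ιP fzero))) αh (preserves α {ιH h} {ιP fzero} _))

  rep-distinct : ∀ j j′ → rep j ≅ rep j′ → j ≡ j′
  rep-distinct (i , a) (i′ , b) r = cong₂ _,_ i≡i′ a≡b
    where
    σ : V F ↔ V F
    σ = relabel r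
    α : F ≃ F
    α = ≅⇒automorphism (rep-transitive (i , a)) (rep-transitive (i′ , b)) r
    τH : Σ (V H ↔ V H) λ τ → ∀ h → ιH (to τ h) ≡ to σ (ιH h)
    τH = restrict-↔ ιH ιH-injective σ (automorphism-keeps-ιH α) (automorphism-keeps-ιH (≃-sym α))
    τP : Σ (Fin (suc q) ↔ Fin (suc q)) λ τ → ∀ u → ιP (to τ u) ≡ to σ (ιP u)
    τP = restrict-↔ ιP ιP-injective σ (automorphism-keeps-ιP α) (automorphism-keeps-ιP (≃-sym α))
    arcs-via : ∀ {x y x′ y′} → x′ ≡ to σ x → y′ ≡ to σ y →
      rep (i , a) x y ≡ rep (i′ , b) x′ y′
    arcs-via ex ey = trans (arcs r _ _) (cong₂ (rep (i′ , b)) (sym ex) (sym ey))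
    i≡i′ : i ≡ i′
    i≡i′ = CH.rep-distinct i i′
      (mk≅ (proj₁ τH) λ h h′ → arcs-via (proj₂ τH h) (proj₂ τH h′))
    τP-id : ∀ u → to (proj₁ τP) u ≡ u
    τP-id = ascending-automorphism-is-id (proj₁ τP) λ u v → arcs-via (proj₂ τP u) (proj₂ τP v)
    a≡b : a ≡ b
    a≡b = above-injective λ u →
      trans (arcs-via (proj₂ τH z₀) (proj₂ τP u)) (cong (above b) (τP-id u))

  module _ {O : Orient (V F)} (t : IsTransOrient (E F) O) where
    open IsTransOrient t

    -- If h and z₀ disagreed on u, transitivity through ιP u would give an arc between h and z₀.
    H→clique-uniform : ∀ h u → O (ιH h) (ιP u) ≡ O (ιH z₀) (ιP u)
    H→clique-uniform h u with O (ιH z₀) (ιP u) in z₀u | O (ιH h) (ιP u) in hu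
    ... | true  | true  = refl
    ... | false | false = refl
    ... | true  | false = ⊥-elim (arcs-are-edges (ιH z₀) (ιH h)
                            (transitive _ (ιP u) _ z₀u (trans (reverse (ιH h) (ιP u) _) (cong not hu))))
    ... | false | true  = ⊥-elim (z₀-isolated h (arcs-are-edges (ιH h) (ιH z₀)
                            (transitive _ (ιP u) _ hu (trans (reverse (ιH z₀) (ιP u) _) (cong not z₀u)))))

  classify : ∀ O → IsTransOrient (E F) O → ∃ λ j → O ≅ rep j
  classify O t = (i , threshold T T-upward) , mk≅ σ arcs′
    where
    open IsTransOrient t
    OH-transitive : IsTransOrient (E H) (comap ιH O)
    OH-transitive = restrict ιH (λ e → e) (λ e → e) t
    i : Fin k
    i = proj₁ (CH.classify (comap ιH O) OH-transitive)
    OH≅ : comap ιH O ≅ CH.rep i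
    OH≅ = proj₂ (CH.classify (comap ιH O) OH-transitive)
    open Ranking {R = comap ιP O} (restrict ιP (λ e → e) (λ e → e) t)
    T : Fin (suc q) → Bool
    T u = O (ιH z₀) (ιP u)
    T-upward : ∀ u v → T u ≡ true → O (ιP u) (ιP v) ≡ true → T v ≡ true
    T-upward u v = transitive (ιH z₀) (ιP u) (ιP v)
    clique-arcs : ∀ h u → O (ιH h) (ιP u) ≡ above (threshold T T-upward) (rank u)
    clique-arcs h u = trans (H→clique-uniform t h u) (ranked-above T T-upward u)
    σ : V F ↔ V F
    σ = (relabel OH≅ ⊎-↔ ranking) ⊎-↔ ↔-id (Fin m)
    arcs′ : ∀ x y → O x y ≡ rep (i , threshold T T-upward) (to σ x) (to σ y)
    arcs′ (inj₁ (inj₁ h)) (inj₁ (inj₁ h′)) = arcs OH≅ h h′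
    arcs′ (inj₁ (inj₁ h)) (inj₁ (inj₂ v))  = clique-arcs h v
    arcs′ (inj₁ (inj₂ u)) (inj₁ (inj₁ h))  =
      trans (reverse (ιH h) (ιP u) _) (cong not (clique-arcs h u))
    arcs′ (inj₁ (inj₂ u)) (inj₁ (inj₂ v))  = arcs ranked u v
    arcs′ (inj₁ x)        (inj₂ w)         = no-arc _ _ λ ()
    arcs′ (inj₂ w)        y                = no-arc _ _ λ ()

  classification : Classification (E F) (Fin k × Fin (suc (suc q)))
  classification = record
    { rep = rep ; rep-transitive = rep-transitive ; rep-distinct = rep-distinct ; classify = classify }

Classified-step : ∀ {G k} → Classified G k → ∀ z p → 1 ≤ z → Classified (G ⊕ z ∨ p) (k * suc p)
Classified-step {G} {k} cG (suc z′) zero _ = record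
  { vertex         = inj₁ (inj₁ CG.vertex)
  ; classification = λ m → subst (Classification _ ∘ Fin) (sym (*-identityʳ k))
      (transport (≃-sym (≃-trans (⊕-cong (∨-zero (G ⊕ suc z′)) m) (⊕-⊕ G (suc z′) m)))
                 (CG.classification (suc z′ + m))) }
  where module CG = Classified cG
Classified-step cG (suc z′) (suc q) _ = record
  { vertex         = inj₁ (inj₁ (Classified.vertex cG))
  ; classification = λ m → reindex (↔-sym *↔×) (Step.classification cG z′ q m) }

build : Graph → List (ℕ × ℕ) → Graph
build G []             = G
build G ((p , z) ∷ bs) = build (G ⊕ z ∨ p) bs

Classified-build : ∀ {G k} bs → All (λ b → 1 ≤ proj₂ b) bs → Classified G k →
  Classified (build G bs) (k * product (map (λ b → suc (proj₁ b)) bs))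
Classified-build {G} {k} []             []       cG = subst (Classified G) (sym (*-identityʳ k)) cG
Classified-build {G} {k} ((p , z) ∷ bs) (z≥1 ∷ zs) cG =
  subst (Classified (build (G ⊕ z ∨ p) bs)) (*-assoc k (suc p) _)
    (Classified-build bs zs (Classified-step cG z p z≥1))

-- Threshold graphs

thresholdGraph : List Sym → Graph
thresholdGraph s = record { V = Vtx s ; E = Adj s ; E-sym = swap }

-- Adj s is AdjBy toℕ (label s) by definition.
AdjBy : {A : Set} → (A → ℕ) → (A → Maybe Sym) → A → A → Set
AdjBy pos lab x y = (pos x < pos y × lab y ≡ just plus) ⊎ (pos y < pos x × lab x ≡ just plus)

AdjBy-relabel : {A B : Set} (pos : A → ℕ) (lab : A → Maybe Sym)
  (pos′ : B → ℕ) (lab′ : B → Maybe Sym) (f : A → B) →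
  (∀ x → pos′ (f x) ≡ pos x) → (∀ x → lab′ (f x) ≡ lab x) →
  (∀ x y → AdjBy pos lab x y → AdjBy pos′ lab′ (f x) (f y)) ×
  (∀ x y → AdjBy pos′ lab′ (f x) (f y) → AdjBy pos lab x y)
AdjBy-relabel pos lab pos′ lab′ f pos-f lab-f = forth , back
  where
  forth : ∀ x y → AdjBy pos lab x y → AdjBy pos′ lab′ (f x) (f y)
  forth x y (inj₁ (lt , l)) = inj₁ (subst₂ _<_ (sym (pos-f x)) (sym (pos-f y)) lt , trans (lab-f y) l)
  forth x y (inj₂ (lt , l)) = inj₂ (subst₂ _<_ (sym (pos-f y)) (sym (pos-f x)) lt , trans (lab-f x) l)
  back : ∀ x y → AdjBy pos′ lab′ (f x) (f y) → AdjBy pos lab x y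
  back x y (inj₁ (lt , l)) = inj₁ (subst₂ _<_ (pos-f x) (pos-f y) lt , trans (sym (lab-f y)) l)
  back x y (inj₂ (lt , l)) = inj₂ (subst₂ _<_ (pos-f y) (pos-f x) lt , trans (sym (lab-f x)) l)

lookupAt : List Sym → ℕ → Maybe Sym
lookupAt []      _       = nothing
lookupAt (x ∷ _) zero    = just x
lookupAt (_ ∷ s) (suc k) = lookupAt s k

-- Position 0 is the vertex ⋆.
labelAt : List Sym → ℕ → Maybe Sym
labelAt s zero    = nothing
labelAt s (suc k) = lookupAt s k

lookup≡lookupAt : ∀ s k → just (lookup s k) ≡ lookupAt s (toℕ k)
lookup≡lookupAt (x ∷ s) fzero    = refl
lookup≡lookupAt (x ∷ s) (fsuc k) = lookup≡lookupAt s k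

label≡labelAt : ∀ s i → label s i ≡ labelAt s (toℕ i)
label≡labelAt s fzero    = refl
label≡labelAt s (fsuc k) = lookup≡lookupAt s k

lookupAt-++ˡ : ∀ s t k → k < length s → lookupAt (s ++ t) k ≡ lookupAt s k
lookupAt-++ˡ (x ∷ s) t zero    _         = refl
lookupAt-++ˡ (x ∷ s) t (suc k) (s≤s k<) = lookupAt-++ˡ s t k k<

lookupAt-++ʳ : ∀ s t k → lookupAt (s ++ t) (length s + k) ≡ lookupAt t k
lookupAt-++ʳ []      t k = refl
lookupAt-++ʳ (x ∷ s) t k = lookupAt-++ʳ s t k

lookupAt-replicate : ∀ {n x k} → k < n → lookupAt (replicate n x) k ≡ just x
lookupAt-replicate {suc n} {k = zero}  _         = refl
lookupAt-replicate {suc n} {k = suc k} (s≤s k<) = lookupAt-replicate k<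

labelAt-++ˡ : ∀ s t c → c < suc (length s) → labelAt (s ++ t) c ≡ labelAt s c
labelAt-++ˡ s t zero    _         = refl
labelAt-++ˡ s t (suc k) (s≤s k<) = lookupAt-++ˡ s t k k<

-- The threshold graph of s extended by n vertices of type x, on the vertex set Vtx s ⊎ Fin n.
module Appended (s : List Sym) (n : ℕ) (x : Sym) where
  pos : Vtx s ⊎ Fin n → ℕ
  pos (inj₁ a) = toℕ a
  pos (inj₂ b) = suc (length s + toℕ b)

  lab : Vtx s ⊎ Fin n → Maybe Sym
  lab (inj₁ a) = label s a
  lab (inj₂ b) = just x

  graph : Graph
  graph = record { V = Vtx s ⊎ Fin n ; E = AdjBy pos lab ; E-sym = swap }

  old<new : ∀ a b → pos (inj₁ a) < pos (inj₂ b)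
  old<new a b = <-≤-trans (toℕ<n a) (s≤s (m≤m+n (length s) (toℕ b)))

  length-appended : suc (length s) + n ≡ suc (length (s ++ replicate n x))
  length-appended = cong suc (sym (trans (length-++ s) (cong (length s +_) (length-replicate n))))

  φ : (Vtx s ⊎ Fin n) ↔ Vtx (s ++ replicate n x)
  φ = mk↔ₛ′ (cast length-appended) (cast (sym length-appended))
        (cast-involutive length-appended (sym length-appended))
        (cast-involutive (sym length-appended) length-appended)
      ↔-∘ ↔-sym (+↔⊎ {suc (length s)} {n})

  pos-φ : ∀ y → toℕ (to φ y) ≡ pos y
  pos-φ (inj₁ a) = trans (toℕ-cast length-appended _) (toℕ-↑ˡ a n)
  pos-φ (inj₂ b) = trans (toℕ-cast length-appended _) (toℕ-↑ʳ (suc (length s)) b)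

  lab-φ : ∀ y → label (s ++ replicate n x) (to φ y) ≡ lab y
  lab-φ y = trans (label≡labelAt _ (to φ y)) (trans (cong (labelAt _) (pos-φ y)) (labelAt-pos y))
    where
    labelAt-pos : ∀ y → labelAt (s ++ replicate n x) (pos y) ≡ lab y
    labelAt-pos (inj₁ a) = trans (labelAt-++ˡ s _ (toℕ a) (toℕ<n a)) (sym (label≡labelAt s a))
    labelAt-pos (inj₂ b) = trans (lookupAt-++ʳ s _ (toℕ b)) (lookupAt-replicate (toℕ<n b))

  graph≃threshold : graph ≃ thresholdGraph (s ++ replicate n x)
  graph≃threshold = mk≃ φ (proj₁ relabelled) (proj₂ relabelled)
    where
    relabelled : (∀ y y′ → AdjBy pos lab y y′ → Adj (s ++ replicate n x) (to φ y) (to φ y′))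
               × (∀ y y′ → Adj (s ++ replicate n x) (to φ y) (to φ y′) → AdjBy pos lab y y′)
    relabelled = AdjBy-relabel pos lab toℕ (label (s ++ replicate n x)) (to φ) pos-φ lab-φ

⊕≃appended : ∀ s n → thresholdGraph s ⊕ n ≃ Appended.graph s n zer
⊕≃appended s n = mk≃ (↔-id _) forth back
  where
  open Appended s n zer
  forth : ∀ x y → E (thresholdGraph s ⊕ n) x y → AdjBy pos lab x y
  forth (inj₁ a) (inj₁ a′) e = e
  back : ∀ x y → AdjBy pos lab x y → E (thresholdGraph s ⊕ n) x y
  back (inj₁ a) (inj₁ a′) e               = e
  back (inj₁ a) (inj₂ b)  (inj₂ (lt , _)) = <-asym lt (old<new a b)
  back (inj₂ b) (inj₁ a)  (inj₁ (lt , _)) = <-asym lt (old<new a b)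

∨≃appended : ∀ s n → thresholdGraph s ∨ n ≃ Appended.graph s n plus
∨≃appended s n = mk≃ (↔-id _) forth back
  where
  open Appended s n plus
  forth : ∀ x y → E (thresholdGraph s ∨ n) x y → AdjBy pos lab x y
  forth (inj₁ a) (inj₁ a′) e   = e
  forth (inj₁ a) (inj₂ b)  _   = inj₁ (old<new a b , refl)
  forth (inj₂ b) (inj₁ a)  _   = inj₂ (old<new a b , refl)
  forth (inj₂ b) (inj₂ b′) b≢b′ with <-cmp (toℕ b) (toℕ b′)
  ... | tri< lt _ _ = inj₁ (s≤s (+-monoʳ-< (length s) lt) , refl)
  ... | tri≈ _ eq _ = contradiction (toℕ-injective eq) b≢b′
  ... | tri> _ _ gt = inj₂ (s≤s (+-monoʳ-< (length s) gt) , refl)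
  back : ∀ x y → AdjBy pos lab x y → E (thresholdGraph s ∨ n) x y
  back (inj₁ a) (inj₁ a′) e                  = e
  back (inj₁ a) (inj₂ b)  _                  = _
  back (inj₂ b) (inj₁ a)  _                  = _
  back (inj₂ b) (inj₂ b′) (inj₁ (lt , _)) refl = <-irrefl refl lt
  back (inj₂ b) (inj₂ b′) (inj₂ (lt , _)) refl = <-irrefl refl lt

appended-zeros : ∀ s n → thresholdGraph s ⊕ n ≃ thresholdGraph (s ++ replicate n zer)
appended-zeros s n = ≃-trans (⊕≃appended s n) (Appended.graph≃threshold s n zer)

appended-pluses : ∀ s n → thresholdGraph s ∨ n ≃ thresholdGraph (s ++ replicate n plus)
appended-pluses s n = ≃-trans (∨≃appended s n) (Appended.graph≃threshold s n plus)

complete≃threshold : ∀ p → complete (suc p) ≃ thresholdGraph (replicate p plus)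
complete≃threshold p = ≃-trans complete≃star∨ (appended-pluses [] p)
  where
  forth : ∀ x y → x ≢ y → E (thresholdGraph [] ∨ p) (to +↔⊎ x) (to +↔⊎ y)
  forth fzero    fzero    x≢y = contradiction refl x≢y
  forth fzero    (fsuc v) _   = _
  forth (fsuc u) fzero    _   = _
  forth (fsuc u) (fsuc v) x≢y = x≢y ∘ cong fsuc
  back : ∀ x y → E (thresholdGraph [] ∨ p) (to +↔⊎ x) (to +↔⊎ y) → x ≢ y
  back fzero    fzero    (inj₁ (() , _))
  back fzero    fzero    (inj₂ (() , _))
  back fzero    (fsuc v) _ ()
  back (fsuc u) fzero    _ ()
  back (fsuc u) (fsuc v) e = e ∘ suc-injective
  complete≃star∨ : complete (suc p) ≃ thresholdGraph [] ∨ p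
  complete≃star∨ = mk≃ +↔⊎ forth back

block : ℕ × ℕ → List Sym
block b = replicate (proj₂ b) zer ++ replicate (proj₁ b) plus

build≃threshold : ∀ {G} s bs → G ≃ thresholdGraph s →
  build G bs ≃ thresholdGraph (s ++ concatMap block bs)
build≃threshold {G} s [] φ = subst (λ l → G ≃ thresholdGraph l) (sym (++-identityʳ s)) φ
build≃threshold {G} s ((p , z) ∷ bs) φ =
  subst (λ l → build (G ⊕ z ∨ p) bs ≃ thresholdGraph l) reassociate
    (build≃threshold ((s ++ zs) ++ ps) bs
      (≃-trans (∨-cong (≃-trans (⊕-cong φ z) (appended-zeros s z)) p) (appended-pluses (s ++ zs) p)))
  where
  zs ps : List Sym
  zs = replicate z zer
  ps = replicate p plus
  reassociate : ((s ++ zs) ++ ps) ++ concatMap block bs ≡ s ++ ((zs ++ ps) ++ concatMap block bs)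
  reassociate = trans (++-assoc (s ++ zs) ps _)
    (trans (++-assoc s zs _) (cong (s ++_) (sym (++-assoc zs ps _))))

toNumTransOrientClasses : ∀ {n} {E : Fin n → Fin n → Set} {k} →
  Classification E (Fin k) → NumTransOrientClasses E k
toNumTransOrientClasses {n} {E} c =
  List.tabulate rep , length-tabulate rep , All.tabulate⁺ (toDefs ∘ rep-transitive) ,
  AllPairs.tabulate⁺ (λ i≢j (σ , σ-arcs) → i≢j (rep-distinct _ _ (mk≅ σ σ-arcs))) ,
  λ O t → let (i , mk≅ σ σ-arcs) = classify O (fromDefs t) in Any.tabulate⁺ i (σ , σ-arcs)
  where
  open Classification c
  toDefs : ∀ {O} → IsTransOrient E O → IsTransitiveOrientation E O
  toDefs t = record { IsTransOrient t }
  fromDefs : ∀ {O} → IsTransitiveOrientation E O → IsTransOrient E O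
  fromDefs t = record { IsTransitiveOrientation t }

theorem3p5 : (p₀ : ℕ) (bs : List (ℕ × ℕ)) →
    All (λ b → 1 ≤ proj₂ b) bs →
    NumTransOrientClasses (Adj (thresholdSeq p₀ bs)) (product (map (λ b → suc (proj₁ b)) bs))
theorem3p5 p₀ bs zs≥1 =
  toNumTransOrientClasses (subst (Classification (Adj (thresholdSeq p₀ bs)) ∘ Fin) (*-identityˡ _)
    (transport threshold≃ (Classified.classification built 0)))
  where
  built : Classified (build (complete (suc p₀)) bs) (1 * product (map (λ b → suc (proj₁ b)) bs))
  built = Classified-build bs zs≥1
    (record { vertex = fzero ; classification = complete⊕-classification (suc p₀) })
  threshold≃ : build (complete (suc p₀)) bs ⊕ 0 ≃ thresholdGraph (thresholdSeq p₀ bs)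
  threshold≃ = ≃-trans (⊕-zero _) (build≃threshold (replicate p₀ plus) bs (complete≃threshold p₀))
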